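{- Fix an integer $h\ge 1$. The relation $\preceq$ on the set of partitions of height $h$ is a partial order. Moreover, for all positive integers $d,n$, one has $(d,d,\dots,d)\preceq(n,n,\dots,n)$ (both sequences of length $h$) if and only if $d$ divides $n$.
   Context: A partition of height $h$ is a sequence $\lambda=(\lambda_1,\dots,\lambda_h)$ of integers with $\lambda_1\ge\lambda_2\ge\dots\ge\lambda_h\ge 1$. An espalier of height $h$ is a finite set of unit cells of $\mathbb Z^3$ (a cell is identified with the smallest coordinates of its vertices) of the form $\mathbb E=\bigcup_{a=0}^{h-1}\{a\}\times\{0,\dots,p_a-1\}\times\{0,\dots,q_a-1\}$, where $p_0\ge p_1\ge\dots\ge p_{h-1}\ge1$ and $q_0\ge\dots\ge q_{h-1}\ge 1$ are integers; its $(a+1)$-th plateau is $\{a\}\times\{0,\dots,p_a-1\}\times\{0,\dots,q_a-1\}$, and $mv(\mathbb E)=(p_0q_0,\dots,p_{h-1}q_{h-1})$ is the sequence of plateau volumes. The projection $\mathbb E_x=\{(a,0,c):(a,b,c)\in\mathbb E\}$ is a Ferrers diagram whose rows have lengths $q_0,\dots,q_{h-1}$; the corresponding partition is denoted $\lambda_x(\mathbb E)=(q_0,\dots,q_{h-1})$. For a partition $\mu$ of height $h$, let $E_\mu$ be the set of espaliers $\mathbb E$ with $mv(\mathbb E)=\mu$. Define $\lambda\preceq\mu$ if and only if there exists $\mathbb E\in E_\mu$ with $\lambda_x(\mathbb E)=\lambda$. -}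

module Defs where

open import Data.Nat using (ℕ; _*_; _≤_)
open import Data.Fin using (Fin) renaming (_≤_ to _≤ᶠ_)
open import Data.Vec using (Vec; lookup; zipWith; replicate)
open import Data.Product using (Σ; ∃; _×_; _,_; proj₁)
open import Relation.Binary.PropositionalEquality using (_≡_)

Decreasing : {h : ℕ} → Vec ℕ h → Set
Decreasing {h} v = (i j : Fin h) → i ≤ᶠ j → lookup v j ≤ lookup v i

Positive : {h : ℕ} → Vec ℕ h → Set
Positive {h} v = (i : Fin h) → 1 ≤ lookup v i

IsPartition : {h : ℕ} → Vec ℕ h → Set
IsPartition v = Decreasing v × Positive v

Partition : ℕ → Set
Partition h = Σ (Vec ℕ h) IsPartition

-- An espalier of height h, given by its (uniquely determined) data
-- p_0 ≥ … ≥ p_{h-1} ≥ 1 and q_0 ≥ … ≥ q_{h-1} ≥ 1; the cell set is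
-- ⋃_a {a} × {0..p_a-1} × {0..q_a-1}, which determines and is determined by (p,q).
record Espalier (h : ℕ) : Set where
  field
    p : Vec ℕ h
    q : Vec ℕ h
    p-part : IsPartition p
    q-part : IsPartition q

open Espalier public

mv : {h : ℕ} → Espalier h → Vec ℕ h
mv E = zipWith _*_ (p E) (q E)

λx : {h : ℕ} → Espalier h → Vec ℕ h
λx E = q E

_∈E_ : {h : ℕ} → Espalier h → Partition h → Set
E ∈E μ = mv E ≡ proj₁ μ

_⪯_ : {h : ℕ} → Partition h → Partition h → Set
_⪯_ {h} λ' μ = ∃ λ (E : Espalier h) → (E ∈E μ) × (λx E ≡ proj₁ λ')

_≈ₚ_ : {h : ℕ} → Partition h → Partition h → Set
λ' ≈ₚ μ = proj₁ λ' ≡ proj₁ μ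

constPart : (h d : ℕ) → 1 ≤ d → Partition h
constPart h d 1≤d = replicate h d , (λ i j _ → ≤-refl') , (λ i → pos i)
  where
  open import Data.Vec.Properties using (lookup-replicate)
  open import Data.Nat.Properties using (≤-reflexive)
  open import Relation.Binary.PropositionalEquality using (sym; subst)
  ≤-refl' : ∀ {i j : Fin h} → lookup (replicate h d) j ≤ lookup (replicate h d) i
  ≤-refl' {i} {j} rewrite lookup-replicate j d | lookup-replicate i d = ≤-reflexive _≡_.refl
  pos : (i : Fin h) → 1 ≤ lookup (replicate h d) i
  pos i rewrite lookup-replicate i d = 1≤d

-- An espalier with profiles (p, q) has plateau-volume sequence p ⊙ q, the
-- pointwise product.  Hence λ ⪯ μ says precisely that μ = m ⊙ λ for some
-- partition m (the p-profile of a witnessing espalier): λ ⪯ μ iff λ has a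
-- "multiplier" to μ.  All properties of ⪯ are read off from this description:
--   * partitions are closed under ⊙, whose unit is (1,…,1) and which is
--     associative; this gives reflexivity and transitivity;
--   * if m ⊙ a = a with a positive then m = (1,…,1), and if m ⊙ m' = (1,…,1)
--     then m' = (1,…,1); this gives antisymmetry;
--   * m ⊙ (d,…,d) = (n,…,n) forces m₀ · d = n (here h ≥ 1 is used), and
--     conversely n = k · d with n ≥ 1 gives the multiplier (k,…,k).
module Submission where

open import Defs
open import Data.Nat using (ℕ; zero; suc; _*_; _≤_; z≤n; s≤s)
open import Data.Nat.Properties using (*-mono-≤; *-assoc; *-identityˡ; *-cancelʳ-≡; m*n≡1⇒n≡1)
open import Data.Nat.Divisibility using (_∣_; divides)
open import Data.Fin using () renaming (zero to fzero; suc to fsuc)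
open import Data.Vec using (Vec; []; _∷_; zipWith; replicate)
open import Data.Vec.Properties
  using (lookup-zipWith; zipWith-assoc; zipWith-identityˡ; zipWith-replicate; ∷-injectiveˡ; ∷-injectiveʳ)
open import Data.Product using (Σ; _×_; _,_; proj₁; proj₂)
open import Function.Bundles using (_⇔_; mk⇔; module Equivalence)
open import Function.Construct.Composition using (_⇔-∘_)
open import Relation.Binary.Structures using (IsPartialOrder)
open import Relation.Binary.PropositionalEquality
  using (_≡_; refl; sym; trans; cong; cong₂; subst; module ≡-Reasoning)

_⊙_ : {h : ℕ} → Vec ℕ h → Vec ℕ h → Vec ℕ h
_⊙_ = zipWith _*_

infixr 7 _⊙_

ones : (h : ℕ) → Vec ℕ h
ones h = replicate h 1

⊙-isPartition : {h : ℕ} (u v : Vec ℕ h) → IsPartition u → IsPartition v → IsPartition (u ⊙ v)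
⊙-isPartition u v (u-dec , u-pos) (v-dec , v-pos) = decreasing , positive
  where
  decreasing : Decreasing (u ⊙ v)
  decreasing i j i≤j
    rewrite lookup-zipWith _*_ i u v | lookup-zipWith _*_ j u v
    = *-mono-≤ (u-dec i j i≤j) (v-dec i j i≤j)
  positive : Positive (u ⊙ v)
  positive i rewrite lookup-zipWith _*_ i u v = *-mono-≤ (u-pos i) (v-pos i)

replicate-isPartition : (h k : ℕ) → 1 ≤ k → IsPartition (replicate h k)
replicate-isPartition h k 1≤k = proj₂ (constPart h k 1≤k)

m*x≡x⇒m≡1 : (m x : ℕ) → 1 ≤ x → m * x ≡ x → m ≡ 1
m*x≡x⇒m≡1 m (suc x) _ eq = *-cancelʳ-≡ m 1 (suc x) (trans eq (sym (*-identityˡ (suc x))))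

⊙-fixes⇒ones : {h : ℕ} (m a : Vec ℕ h) → Positive a → m ⊙ a ≡ a → m ≡ ones h
⊙-fixes⇒ones [] [] _ _ = refl
⊙-fixes⇒ones (x ∷ m) (y ∷ a) a-pos eq =
  cong₂ _∷_ (m*x≡x⇒m≡1 x y (a-pos fzero) (∷-injectiveˡ eq))
            (⊙-fixes⇒ones m a (λ i → a-pos (fsuc i)) (∷-injectiveʳ eq))

⊙≡ones⇒ones : {h : ℕ} (u v : Vec ℕ h) → u ⊙ v ≡ ones h → v ≡ ones h
⊙≡ones⇒ones [] [] _ = refl
⊙≡ones⇒ones (x ∷ u) (y ∷ v) eq =
  cong₂ _∷_ (m*n≡1⇒n≡1 x y (∷-injectiveˡ eq)) (⊙≡ones⇒ones u v (∷-injectiveʳ eq))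

⊙-replicate⇒∣ : {h d n : ℕ} → 1 ≤ h → (m : Vec ℕ h) → m ⊙ replicate h d ≡ replicate h n → d ∣ n
⊙-replicate⇒∣ {suc h} _ (k ∷ m) eq = divides k (sym (∷-injectiveˡ eq))

Multiplier : {h : ℕ} → Partition h → Partition h → Set
Multiplier {h} λ' μ = Σ (Vec ℕ h) λ m → IsPartition m × m ⊙ proj₁ λ' ≡ proj₁ μ

-- λ ⪯ μ iff λ has a multiplier to μ: the espalier (p, q) ∈ E_μ with
-- λ_x = q = λ corresponds to the multiplier p.
⪯⇔Multiplier : {h : ℕ} (λ' μ : Partition h) → (λ' ⪯ μ) ⇔ Multiplier λ' μ
⪯⇔Multiplier {h} λ' μ = mk⇔ toMultiplier fromMultiplier
  where
  toMultiplier : λ' ⪯ μ → Multiplier λ' μ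
  toMultiplier (E , mv≡μ , q≡λ) = p E , p-part E , trans (cong (p E ⊙_) (sym q≡λ)) mv≡μ
  fromMultiplier : Multiplier λ' μ → λ' ⪯ μ
  fromMultiplier (m , m-part , m⊙λ≡μ) =
    record { p = m ; q = proj₁ λ' ; p-part = m-part ; q-part = proj₂ λ' } , m⊙λ≡μ , refl

Multiplier-reflexive : {h : ℕ} {a b : Partition h} → a ≈ₚ b → Multiplier a b
Multiplier-reflexive {h} {a} a≈b =
  ones h , replicate-isPartition h 1 (s≤s z≤n) , trans (zipWith-identityˡ *-identityˡ (proj₁ a)) a≈b

Multiplier-trans : {h : ℕ} {a b c : Partition h} → Multiplier a b → Multiplier b c → Multiplier a c
Multiplier-trans {a = a} {b} {c} (m , m-part , m⊙a≡b) (m' , m'-part , m'⊙b≡c) =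
  m' ⊙ m , ⊙-isPartition m' m m'-part m-part , composite
  where
  open ≡-Reasoning
  composite : (m' ⊙ m) ⊙ proj₁ a ≡ proj₁ c
  composite = begin
    (m' ⊙ m) ⊙ proj₁ a ≡⟨ zipWith-assoc *-assoc m' m (proj₁ a) ⟩
    m' ⊙ (m ⊙ proj₁ a) ≡⟨ cong (m' ⊙_) m⊙a≡b ⟩
    m' ⊙ proj₁ b       ≡⟨ m'⊙b≡c ⟩
    proj₁ c            ∎

-- Mutual multipliers are trivial: m' ⊙ m fixes the positive sequence a,
-- so m' ⊙ m = (1,…,1), hence m = (1,…,1) and b = m ⊙ a = a.
Multiplier-antisym : {h : ℕ} {a b : Partition h} → Multiplier a b → Multiplier b a → a ≈ₚ b
Multiplier-antisym {h} {a} {b} ab@(m , _ , m⊙a≡b) ba =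
  begin
    proj₁ a            ≡⟨ sym (zipWith-identityˡ *-identityˡ (proj₁ a)) ⟩
    ones h ⊙ proj₁ a   ≡⟨ cong (_⊙ proj₁ a) (sym m≡ones) ⟩
    m ⊙ proj₁ a        ≡⟨ m⊙a≡b ⟩
    proj₁ b            ∎
  where
  open ≡-Reasoning
  round-trip : Multiplier a a
  round-trip = Multiplier-trans {a = a} {b} {a} ab ba
  m≡ones : m ≡ ones h
  m≡ones = ⊙≡ones⇒ones (proj₁ ba) m
             (⊙-fixes⇒ones (proj₁ round-trip) (proj₁ a) (proj₂ (proj₂ a)) (proj₂ (proj₂ round-trip)))

quotient-positive : {k d n : ℕ} → 1 ≤ n → n ≡ k * d → 1 ≤ k
quotient-positive {zero} 1≤n n≡0 with subst (1 ≤_) n≡0 1≤n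
... | ()
quotient-positive {suc k} _ _ = s≤s z≤n

-- (d,…,d) ⪯ (n,…,n) iff d ∣ n, for height h ≥ 1: a multiplier must send
-- d to n in the first coordinate, and n = k · d gives the multiplier (k,…,k).
constant-Multiplier⇔∣ : (h : ℕ) → 1 ≤ h → (d n : ℕ) (1≤d : 1 ≤ d) (1≤n : 1 ≤ n) →
  Multiplier (constPart h d 1≤d) (constPart h n 1≤n) ⇔ (d ∣ n)
constant-Multiplier⇔∣ h 1≤h d n 1≤d 1≤n = mk⇔ toDivides fromDivides
  where
  toDivides : Multiplier (constPart h d 1≤d) (constPart h n 1≤n) → d ∣ n
  toDivides (m , _ , m⊙d≡n) = ⊙-replicate⇒∣ 1≤h m m⊙d≡n
  fromDivides : d ∣ n → Multiplier (constPart h d 1≤d) (constPart h n 1≤n)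
  fromDivides (divides k n≡k*d) =
    replicate h k , replicate-isPartition h k (quotient-positive 1≤n n≡k*d) ,
    trans (zipWith-replicate _*_ k d) (cong (replicate h) (sym n≡k*d))

mainTheorem1 : (h : ℕ) → 1 ≤ h →
    IsPartialOrder (_≈ₚ_ {h}) (_⪯_ {h})
    × ((d n : ℕ) → (1≤d : 1 ≤ d) → (1≤n : 1 ≤ n) →
        (constPart h d 1≤d ⪯ constPart h n 1≤n) ⇔ (d ∣ n))
mainTheorem1 h 1≤h = partialOrder , divisibility
  where
  open Equivalence using (to; from)
  partialOrder : IsPartialOrder (_≈ₚ_ {h}) (_⪯_ {h})
  partialOrder = record
    { isPreorder = record
      { isEquivalence = record { refl = refl ; sym = sym ; trans = trans }
      ; reflexive = λ {a} {b} a≈b → from (⪯⇔Multiplier a b) (Multiplier-reflexive {a = a} {b} a≈b)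
      ; trans = λ {a} {b} {c} a⪯b b⪯c →
          from (⪯⇔Multiplier a c) (Multiplier-trans {a = a} {b} {c} (to (⪯⇔Multiplier a b) a⪯b) (to (⪯⇔Multiplier b c) b⪯c))
      }
    ; antisym = λ {a} {b} a⪯b b⪯a → Multiplier-antisym {a = a} {b} (to (⪯⇔Multiplier a b) a⪯b) (to (⪯⇔Multiplier b a) b⪯a)
    }
  divisibility : (d n : ℕ) → (1≤d : 1 ≤ d) → (1≤n : 1 ≤ n) →
    (constPart h d 1≤d ⪯ constPart h n 1≤n) ⇔ (d ∣ n)
  divisibility d n 1≤d 1≤n =
    constant-Multiplier⇔∣ h 1≤h d n 1≤d 1≤n ⇔-∘ ⪯⇔Multiplier (constPart h d 1≤d) (constPart h n 1≤n)
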